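{- Let $i$ be an inert term and $\pi\triangleright\Gamma\vdash i:M$ a type derivation. If $\Gamma$ is an inert type context, then $M$ is an inert multi type and $\pi$ is an inert derivation.
   Context: Terms: $t,u ::= x \mid \lambda x.t \mid tu$, up to $\alpha$-equivalence. Values: $v ::= x \mid \lambda x.t$. Fireballs $f$ and inert terms $i$ are defined by mutual induction: $f ::= v \mid i$ and $i ::= x f_1 \dots f_n$ with $n>0$ (application left-associative). Multi types: linear types $L ::= M\multimap N$; multi types $M,N ::= [L_1,\dots,L_n]$ (finite multisets, $n\ge 0$); $\mathbf 0$ empty multiset, $\uplus$ multiset sum. Type context $\Gamma$: total map from variables to multi types with finite $\mathrm{dom}(\Gamma)=\{x\mid \Gamma(x)\ne\mathbf 0\}$; $(\Gamma\uplus\Delta)(x)=\Gamma(x)\uplus\Delta(x)$; $x:M$ maps $x$ to $M$ and all else to $\mathbf 0$; $\Gamma,x:M$ extends $\Gamma$ ($x\notin\mathrm{dom}(\Gamma)$) by $x\mapsto M$. Typing rules: (ax) $x:M\vdash x:M$; (@) from $\Gamma\vdash t:[M\multimap N]$ and $\Delta\vdash u:M$ infer $\Gamma\uplus\Delta\vdash tu:N$; ($\lambda$) from $\Gamma_k,x:M_k\vdash t:N_k$ for $k=1,\dots,n$ ($n\ge0$) infer $\Gamma_1\uplus\dots\uplus\Gamma_n\vdash\lambda x.t:[M_1\multimap N_1,\dots,M_n\multimap N_n]$. Inert multi types are defined inductively as finite multisets (possibly empty) of linear types $\mathbf 0\multimap N$ with $N$ an inert multi type; a type context is inert if all its values are inert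 multi types. A derivation $\pi\triangleright\Gamma\vdash e:M$ is inert if $\Gamma$ and $M$ are inert. -}

module Defs where

open import Data.Nat using (ℕ; _≡ᵇ_)
open import Data.Bool using (if_then_else_)
open import Data.List using (List; []; _∷_; _++_; [_])
open import Data.List.Relation.Binary.Permutation.Propositional using (_↭_)
open import Data.List.Relation.Binary.Pointwise using (Pointwise)
open import Data.Product using (_×_)
open import Relation.Binary.PropositionalEquality using (_≡_)

data Term : Set where
  var : ℕ → Term
  lam : ℕ → Term → Term
  app : Term → Term → Term

mutual
  data IsFireball : Term → Set where
    fb-var   : ∀ x → IsFireball (var x)
    fb-lam   : ∀ x t → IsFireball (lam x t)
    fb-inert : ∀ {i} → IsInert i → IsFireball i

  data IsInert : Term → Set where
    inert-head : ∀ {x f} → IsFireball f → IsInert (app (var x) f)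
    inert-app  : ∀ {i f} → IsInert i → IsFireball f → IsInert (app i f)

-- Multi types.  Multisets are represented by lists; multiset equality is
-- the relation _≈M_ below (permutation, recursively up to _≈L_).

data Lin : Set where
  _⊸_ : List Lin → List Lin → Lin

Multi : Set
Multi = List Lin

𝟎 : Multi
𝟎 = []

mutual
  data _≈L_ : Lin → Lin → Set where
    ⊸-cong : ∀ {M M′ N N′} → M ≈M M′ → N ≈M N′ → (M ⊸ N) ≈L (M′ ⊸ N′)

  data _≈M_ : Multi → Multi → Set where
    perm : ∀ {M M′ N} → M ↭ M′ → Pointwise _≈L_ M′ N → M ≈M N

Ctx : Set
Ctx = ℕ → Multi

∅ : Ctx
∅ _ = 𝟎

_⊎_ : Ctx → Ctx → Ctx
(Γ ⊎ Δ) y = Γ y ++ Δ y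

_↦_ : ℕ → Multi → Ctx
(x ↦ M) y = if y ≡ᵇ x then M else 𝟎

-- Γ , x : M   (used only when Γ x ≡ 𝟎, i.e. x ∉ dom Γ)
_,_∶_ : Ctx → ℕ → Multi → Ctx
(Γ , x ∶ M) y = if y ≡ᵇ x then M else Γ y

-- The λ-rule with n ≥ 0 premises is rendered via LamPrems, which
-- collects the n premises Γₖ , x : Mₖ ⊢ t : Nₖ (with x ∉ dom Γₖ) and
-- produces the context Γ₁ ⊎ … ⊎ Γₙ and type [M₁ ⊸ N₁, …, Mₙ ⊸ Nₙ].

mutual
  data _⊢_∶_ : Ctx → Term → Multi → Set where
    ax  : ∀ x M → (x ↦ M) ⊢ var x ∶ M
    app : ∀ {Γ Δ t u M M′ N} →
          Γ ⊢ t ∶ [ M ⊸ N ] → Δ ⊢ u ∶ M′ → M ≈M M′ →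
          (Γ ⊎ Δ) ⊢ app t u ∶ N
    lam : ∀ {Γ x t Ms} → LamPrems x t Γ Ms → Γ ⊢ lam x t ∶ Ms

  data LamPrems (x : ℕ) (t : Term) : Ctx → Multi → Set where
    []  : LamPrems x t ∅ []
    _∷_ : ∀ {Γ Γs M N Ms} →
          (Γ x ≡ 𝟎) × ((Γ , x ∶ M) ⊢ t ∶ N) →
          LamPrems x t Γs Ms →
          LamPrems x t (Γ ⊎ Γs) ((M ⊸ N) ∷ Ms)

data InertM : Multi → Set where
  []  : InertM []
  _∷_ : ∀ {N Ms} → InertM N → InertM Ms → InertM ((𝟎 ⊸ N) ∷ Ms)

InertCtx : Ctx → Set
InertCtx Γ = ∀ x → InertM (Γ x)

InertDeriv : ∀ {Γ e M} → Γ ⊢ e ∶ M → Set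
InertDeriv {Γ} {e} {M} _ = InertCtx Γ × InertM M

-- An inert term x f₁ … fₙ is typed by n application rules over the head x.
-- Every sub-multiset of an inert type and every sub-context of an inert
-- context is inert, so the head gets an inert type, and each application
-- step passes from an inert singleton [𝟎 ⊸ N] to its inert target N; the
-- arguments fₖ never matter.
module Submission where

open import Defs
open import Data.Product using (_×_; _,_)
open import Data.List using ([]; _∷_; _++_; [_])
open import Data.Nat using (zero; suc)
open import Relation.Binary.PropositionalEquality using (_≡_; refl; subst)

InertM-++⁻ˡ : ∀ {M N} → InertM (M ++ N) → InertM M
InertM-++⁻ˡ {[]}    _          = []
InertM-++⁻ˡ {_ ∷ M} (iN ∷ iMN) = iN ∷ InertM-++⁻ˡ iMN

InertM-[⊸]⁻ : ∀ {M N} → InertM [ M ⊸ N ] → InertM N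
InertM-[⊸]⁻ (iN ∷ []) = iN

InertCtx-⊎⁻ˡ : ∀ {Γ Δ} → InertCtx (Γ ⊎ Δ) → InertCtx Γ
InertCtx-⊎⁻ˡ iΓΔ y = InertM-++⁻ˡ (iΓΔ y)

↦-self : ∀ x M → (x ↦ M) x ≡ M
↦-self zero    M = refl
↦-self (suc x) M = ↦-self x M

var-type-inert : ∀ {Γ x M} → Γ ⊢ var x ∶ M → InertCtx Γ → InertM M
var-type-inert (ax x M) iΓ = subst InertM (↦-self x M) (iΓ x)

inert-type-inert : ∀ {Γ i M} → IsInert i → Γ ⊢ i ∶ M → InertCtx Γ → InertM M
inert-type-inert (inert-head _) (app πx _ _) iΓ =
  InertM-[⊸]⁻ (var-type-inert πx (InertCtx-⊎⁻ˡ iΓ))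
inert-type-inert (inert-app ii _) (app πi _ _) iΓ =
  InertM-[⊸]⁻ (inert-type-inert ii πi (InertCtx-⊎⁻ˡ iΓ))

lemma6 : ∀ {Γ : Ctx} {i : Term} {M : Multi} → IsInert i → (π : Γ ⊢ i ∶ M) →
           InertCtx Γ → InertM M × InertDeriv π
lemma6 {M = M} ii π iΓ = iM , iΓ , iM
  where
  iM : InertM M
  iM = inert-type-inert ii π iΓ
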